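{- Let $G=(V,E)$ be a (simple) graph on $n$ vertices with girth at least $5$. Then $\sum_{v\in V:\ d(v)\geq 2\sqrt n} d(v)\leq 2n$, where $d(v)$ is the degree of $v$.
   Context: The girth of a graph is the length of its shortest cycle (infinite if the graph is acyclic). -}

module Defs where

open import Data.Nat using (ℕ; zero; suc; _+_; _*_; _≤_; _<_; _≤?_)
open import Data.Fin using (Fin; toℕ)
open import Data.Bool using (Bool; true; false; T)
open import Data.List using (List; length; filter; map)
open import Data.Nat.ListAction using (sum)
open import Data.Sum using (_⊎_)
open import Data.Product using (_×_; Σ)
open import Function.Definitions using (Injective)
open import Relation.Binary.PropositionalEquality using (_≡_)
open import Relation.Nullary using (¬_)
open import Data.List using (allFin)
open import Data.Bool.Properties using (T?)

record Graph (n : ℕ) : Set where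
  field
    adj    : Fin n → Fin n → Bool
    sym    : ∀ u v → adj u v ≡ adj v u
    irrefl : ∀ v → adj v v ≡ false
open Graph public

record Cycle {n : ℕ} (G : Graph n) (k : ℕ) : Set where
  field
    len≥3    : 3 ≤ k
    vertex   : Fin k → Fin n
    distinct : Injective _≡_ _≡_ vertex
    edges    : ∀ (i j : Fin k) →
               (suc (toℕ i) ≡ toℕ j ⊎ (suc (toℕ i) ≡ k × toℕ j ≡ 0)) →
               adj G (vertex i) (vertex j) ≡ true

GirthAtLeast : {n : ℕ} → Graph n → ℕ → Set
GirthAtLeast G g = ∀ k → k < g → ¬ Cycle G k

degree : {n : ℕ} → Graph n → Fin n → ℕ
degree {n} G v = length (filter (λ u → T? (adj G v u)) (allFin n))

-- Sum of degrees of vertices v with d(v) ≥ 2√n, i.e. (as d(v) ≥ 0) d(v)² ≥ 4n.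
highDegreeSum : {n : ℕ} → Graph n → ℕ
highDegreeSum {n} G =
  sum (map (degree G)
           (filter (λ v → (4 * n) ≤? (degree G v * degree G v)) (allFin n)))

module Submission where

-- Girth ≥ 5 forbids 4-cycles, so two distinct vertices have at most one
-- common neighbour.  Let H be the set of vertices v with d(v)² ≥ 4n,
-- h = |H| and D = Σ_{v∈H} d(v).  Counting, for every vertex u, the number
-- c(u) of its neighbours in H gives
--   Σ_u c(u) = D   and   Σ_u c(u)² = Σ_{v,w∈H} codeg(v,w) ≤ D + h²,
-- so Cauchy–Schwarz yields D² ≤ n (D + h²).  Since every v ∈ H has
-- d(v) ≥ 2√n, also 4n h² ≤ D².  Together 3D² ≤ 4nD, i.e. D ≤ 4n/3 ≤ 2n.

open import Defs hiding (sym)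
open import Data.Bool using (Bool; true; false; _∧_)
open import Data.Bool.Properties using (T?)
open import Data.Fin using (Fin; zero; suc; toℕ; punchIn)
open import Data.Fin.Properties using (toℕ-injective; toℕ<n; suc-injective; punchInᵢ≢i)
  renaming (_≟_ to _≟ᶠ_)
open import Data.List using (length; filter; map; tabulate)
import Data.Nat.ListAction as List
open import Data.Nat
open import Data.Nat.Properties hiding (suc-injective)
open import Data.Nat.Tactic.RingSolver using (solve-∀)
open import Algebra.Properties.Semiring.Sum +-*-semiring
  using (sum; sum-syntax; sum-cong-≗; sum-remove; sum-replicate-zero;
         ∑-comm; ∑-distrib-+; *-distribˡ-sum; *-distribʳ-sum)
open import Data.Product using (_×_; _,_)
open import Data.Sum using (_⊎_; inj₁; inj₂; [_,_]′)
open import Data.Vec.Functional using (removeAt)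
open import Function using (_∘_; id)
open import Function.Definitions using (Injective)
open import Relation.Binary.PropositionalEquality
open import Relation.Nullary using (Dec; yes; no; does; contradiction)
open import Relation.Unary using (Pred; Decidable)

χ : Bool → ℕ
χ true  = 1
χ false = 0

χ-∧ : ∀ a b → χ (a ∧ b) ≡ χ a * χ b
χ-∧ true  b = sym (+-identityʳ (χ b))
χ-∧ false b = refl

χ-idem : ∀ b → χ b * χ b ≡ χ b
χ-idem true  = refl
χ-idem false = refl

∧-true : ∀ {a b} → a ∧ b ≡ true → a ≡ true × b ≡ true
∧-true {true} {true} _ = refl , refl

∑-mono : ∀ {n} {f g : Fin n → ℕ} → (∀ i → f i ≤ g i) → sum f ≤ sum g
∑-mono {zero}  _   = z≤n
∑-mono {suc n} f≤g = +-mono-≤ (f≤g zero) (∑-mono (f≤g ∘ suc))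

∑-const : ∀ n c → ∑[ i < n ] c ≡ n * c
∑-const zero    c = refl
∑-const (suc n) c = cong (c +_) (∑-const n c)

∑-product : ∀ {m n} (f : Fin m → ℕ) (g : Fin n → ℕ) →
            sum f * sum g ≡ ∑[ i < m ] ∑[ j < n ] (f i * g j)
∑-product f g =
  trans (*-distribʳ-sum (sum g) f) (sum-cong-≗ (λ i → *-distribˡ-sum (f i) g))

∑∑-scale : ∀ {m n} x (f : Fin m → Fin n → ℕ) →
           x * ∑[ i < m ] ∑[ j < n ] f i j ≡ ∑[ i < m ] ∑[ j < n ] (x * f i j)
∑∑-scale {n = n} x f =
  trans (*-distribˡ-sum x (λ i → ∑[ j < n ] f i j)) (sum-cong-≗ (λ i → *-distribˡ-sum x (f i)))

∑-single-out : ∀ {n} (v : Fin n) {f g : Fin n → ℕ} →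
               (∀ w → w ≢ v → f w ≤ g w) → sum f ≤ f v + sum g
∑-single-out {suc n} v {f} {g} f≤g = begin
  sum f                              ≡⟨ sum-remove f ⟩
  f v + sum (removeAt f v)           ≤⟨ +-monoʳ-≤ (f v) rest≤ ⟩
  f v + sum (removeAt g v)           ≤⟨ +-monoʳ-≤ (f v) (m≤n+m _ (g v)) ⟩
  f v + (g v + sum (removeAt g v))   ≡⟨ cong (f v +_) (sym (sum-remove g)) ⟩
  f v + sum g                        ∎
  where
  open ≤-Reasoning
  rest≤ : sum (removeAt f v) ≤ sum (removeAt g v)
  rest≤ = ∑-mono (λ j → f≤g (punchIn v j) (punchInᵢ≢i v j))

∑-χ-unique : ∀ {n} (b : Fin n → Bool) →
             (∀ i j → b i ≡ true → b j ≡ true → i ≡ j) → ∑[ i < n ] χ (b i) ≤ 1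
∑-χ-unique {zero}  b uniq = z≤n
∑-χ-unique {suc n} b uniq with b zero in b₀
... | false = ∑-χ-unique (b ∘ suc) (λ i j p q → suc-injective (uniq (suc i) (suc j) p q))
... | true  = s≤s (≤-reflexive (trans (sum-cong-≗ others) (sum-replicate-zero n)))
  where
  others : ∀ i → χ (b (suc i)) ≡ 0
  others i with b (suc i) in bᵢ
  ... | false = refl
  ... | true  = contradiction (uniq zero (suc i) b₀ bᵢ) λ ()

2ab≤a²+b² : ∀ a b → 2 * (a * b) ≤ a * a + b * b
2ab≤a²+b² a b = [ ordered , swapped ]′ (≤-total a b)
  where
  -- For x ≤ y = x + k, the difference of the two sides is exactly k².
  ordered : ∀ {x y} → x ≤ y → 2 * (x * y) ≤ x * x + y * y
  ordered {x} x≤y with k , refl ← m≤n⇒∃[o]m+o≡n x≤y =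
    ≤-trans (m≤m+n _ (k * k)) (≤-reflexive (sym (expand x k)))
    where
    expand : ∀ x k → x * x + (x + k) * (x + k) ≡ 2 * (x * (x + k)) + k * k
    expand = solve-∀

  swapped : b ≤ a → 2 * (a * b) ≤ a * a + b * b
  swapped b≤a =
    subst₂ _≤_ (cong (2 *_) (*-comm b a)) (+-comm (b * b) (a * a)) (ordered b≤a)

-- Cauchy–Schwarz over ℕ: (Σ f)² ≤ n · Σ f².  Summing 2 f(i) f(j) ≤ f(i)² + f(j)²
-- over all pairs (i, j) gives 2 (Σ f)² ≤ 2 n Σ f².
cauchy-schwarz : ∀ {n} (f : Fin n → ℕ) → sum f * sum f ≤ n * ∑[ i < n ] (f i * f i)
cauchy-schwarz {n} f = *-cancelˡ-≤ 2 (begin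
  2 * (sum f * sum f)                   ≡⟨ cong (2 *_) (∑-product f f) ⟩
  2 * ∑[ i < n ] ∑[ j < n ] (f i * f j) ≡⟨ ∑∑-scale 2 (λ i j → f i * f j) ⟩
  ∑[ i < n ] ∑[ j < n ] (2 * (f i * f j))
    ≤⟨ ∑-mono (λ i → ∑-mono (λ j → 2ab≤a²+b² (f i) (f j))) ⟩
  ∑[ i < n ] ∑[ j < n ] (sq i + sq j)   ≡⟨ sum-cong-≗ (λ i → ∑-distrib-+ (λ _ → sq i) sq) ⟩
  ∑[ i < n ] (∑[ j < n ] sq i + Q)      ≡⟨ sum-cong-≗ (λ i → cong (_+ Q) (∑-const n (sq i))) ⟩
  ∑[ i < n ] (n * sq i + Q)             ≡⟨ ∑-distrib-+ (λ i → n * sq i) (λ _ → Q) ⟩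
  ∑[ i < n ] (n * sq i) + ∑[ i < n ] Q  ≡⟨ cong₂ _+_ (sym (*-distribˡ-sum n sq)) (∑-const n Q) ⟩
  n * Q + n * Q                         ≡⟨ cong (n * Q +_) (sym (+-identityʳ (n * Q))) ⟩
  2 * (n * Q)                           ∎)
  where
  open ≤-Reasoning
  sq : Fin n → ℕ
  sq i = f i * f i
  Q : ℕ
  Q = sum sq

≤-square-min : ∀ {K} a b → K ≤ a * a → K ≤ b * b → K ≤ a * b
≤-square-min a b K≤a² K≤b² with ≤-total a b
... | inj₁ a≤b = ≤-trans K≤a² (*-monoʳ-≤ a a≤b)
... | inj₂ b≤a = ≤-trans K≤b² (*-monoˡ-≤ b b≤a)

∑-selected-square : ∀ {n} K (f : Fin n → ℕ) (K≤? : ∀ i → Dec (K ≤ f i * f i)) →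
  let s = λ i → χ (does (K≤? i)) in
  K * (sum s * sum s) ≤ sum (λ i → s i * f i) * sum (λ i → s i * f i)
∑-selected-square {n} K f K≤? = begin
  K * (sum s * sum s)                   ≡⟨ cong (K *_) (∑-product s s) ⟩
  K * ∑[ i < n ] ∑[ j < n ] (s i * s j) ≡⟨ ∑∑-scale K (λ i j → s i * s j) ⟩
  ∑[ i < n ] ∑[ j < n ] (K * (s i * s j))
    ≤⟨ ∑-mono (λ i → ∑-mono (λ j → pair i j)) ⟩
  ∑[ i < n ] ∑[ j < n ] ((s i * f i) * (s j * f j))
    ≡⟨ sym (∑-product (λ i → s i * f i) (λ j → s j * f j)) ⟩
  sum (λ i → s i * f i) * sum (λ i → s i * f i) ∎
  where
  open ≤-Reasoning
  s : Fin n → ℕ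
  s i = χ (does (K≤? i))
  pair : ∀ i j → K * (s i * s j) ≤ (s i * f i) * (s j * f j)
  pair i j with K≤? i | K≤? j
  ... | yes K≤fᵢ² | yes K≤fⱼ² =
    subst₂ _≤_ (sym (*-identityʳ K)) (sym (cong₂ _*_ (*-identityˡ (f i)) (*-identityˡ (f j))))
           (≤-square-min (f i) (f j) K≤fᵢ² K≤fⱼ²)
  ... | yes _ | no _ = ≤-trans (≤-reflexive (*-zeroʳ K)) z≤n
  ... | no _  | _    = ≤-trans (≤-reflexive (*-zeroʳ K)) z≤n

length-filter-tabulate : ∀ {a p} {A : Set a} {P : Pred A p} (P? : Decidable P)
  {m} (f : Fin m → A) → length (filter P? (tabulate f)) ≡ ∑[ i < m ] χ (does (P? (f i)))
length-filter-tabulate P? {zero}  f = refl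
length-filter-tabulate P? {suc m} f with does (P? (f zero))
... | true  = cong suc (length-filter-tabulate P? (f ∘ suc))
... | false = length-filter-tabulate P? (f ∘ suc)

sum-filter-tabulate : ∀ {a p} {A : Set a} {P : Pred A p} (P? : Decidable P) (w : A → ℕ)
  {m} (f : Fin m → A) →
  List.sum (map w (filter P? (tabulate f))) ≡ ∑[ i < m ] (χ (does (P? (f i))) * w (f i))
sum-filter-tabulate P? w {zero}  f = refl
sum-filter-tabulate P? w {suc m} f with does (P? (f zero))
... | true  = cong₂ _+_ (sym (+-identityʳ (w (f zero)))) (sum-filter-tabulate P? w (f ∘ suc))
... | false = sum-filter-tabulate P? w (f ∘ suc)

next₄ : Fin 4 → Fin 4
next₄ zero                   = suc zero
next₄ (suc zero)             = suc (suc zero)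
next₄ (suc (suc zero))       = suc (suc (suc zero))
next₄ (suc (suc (suc zero))) = zero

cycle-step₄ : ∀ (i j : Fin 4) → (suc (toℕ i) ≡ toℕ j ⊎ (suc (toℕ i) ≡ 4 × toℕ j ≡ 0)) →
              j ≡ next₄ i
cycle-step₄ zero                   j (inj₁ e)       = toℕ-injective (sym e)
cycle-step₄ (suc zero)             j (inj₁ e)       = toℕ-injective (sym e)
cycle-step₄ (suc (suc zero))       j (inj₁ e)       = toℕ-injective (sym e)
cycle-step₄ (suc (suc (suc zero))) j (inj₁ e)       = contradiction (toℕ<n j) (<-irrefl (sym e))
cycle-step₄ (suc (suc (suc zero))) j (inj₂ (_ , e)) = toℕ-injective e
cycle-step₄ zero                   j (inj₂ (() , _))
cycle-step₄ (suc zero)             j (inj₂ (() , _))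
cycle-step₄ (suc (suc zero))       j (inj₂ (() , _))

module _ {n : ℕ} (G : Graph n) where

  cycle₄ : (c : Fin 4 → Fin n) → Injective _≡_ _≡_ c →
           (∀ i → adj G (c i) (c (next₄ i)) ≡ true) → Cycle G 4
  cycle₄ c injective step = record
    { len≥3    = n≤1+n 3
    ; vertex   = c
    ; distinct = injective
    ; edges    = λ i j i→j →
        subst (λ k → adj G (c i) (c k) ≡ true) (sym (cycle-step₄ i j i→j)) (step i)
    }

  adjacent⇒distinct : ∀ {x y} → adj G x y ≡ true → x ≢ y
  adjacent⇒distinct {x} xy refl = contradiction (trans (sym xy) (irrefl G x)) λ ()

  common-neighbours⇒cycle : ∀ {v w u u′} → v ≢ w → u ≢ u′ →
    adj G u v ≡ true → adj G u w ≡ true → adj G u′ v ≡ true → adj G u′ w ≡ true →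
    Cycle G 4
  common-neighbours⇒cycle {v} {w} {u} {u′} v≢w u≢u′ uv uw u′v u′w = cycle₄ c distinct step
    where
    c : Fin 4 → Fin n
    c zero                   = v
    c (suc zero)             = u
    c (suc (suc zero))       = w
    c (suc (suc (suc zero))) = u′

    v≢u : v ≢ u
    v≢u = adjacent⇒distinct uv ∘ sym
    u≢w : u ≢ w
    u≢w = adjacent⇒distinct uw
    v≢u′ : v ≢ u′
    v≢u′ = adjacent⇒distinct u′v ∘ sym
    w≢u′ : w ≢ u′
    w≢u′ = adjacent⇒distinct u′w ∘ sym

    distinct : Injective _≡_ _≡_ c
    distinct {zero}                   {zero}                   _ = refl
    distinct {zero}                   {suc zero}               e = contradiction e v≢u
    distinct {zero}                   {suc (suc zero)}         e = contradiction e v≢w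
    distinct {zero}                   {suc (suc (suc zero))}   e = contradiction e v≢u′
    distinct {suc zero}               {zero}                   e = contradiction (sym e) v≢u
    distinct {suc zero}               {suc zero}               _ = refl
    distinct {suc zero}               {suc (suc zero)}         e = contradiction e u≢w
    distinct {suc zero}               {suc (suc (suc zero))}   e = contradiction e u≢u′
    distinct {suc (suc zero)}         {zero}                   e = contradiction (sym e) v≢w
    distinct {suc (suc zero)}         {suc zero}               e = contradiction (sym e) u≢w
    distinct {suc (suc zero)}         {suc (suc zero)}         _ = refl
    distinct {suc (suc zero)}         {suc (suc (suc zero))}   e = contradiction e w≢u′
    distinct {suc (suc (suc zero))}   {zero}                   e = contradiction (sym e) v≢u′
    distinct {suc (suc (suc zero))}   {suc zero}               e = contradiction (sym e) u≢u′
    distinct {suc (suc (suc zero))}   {suc (suc zero)}         e = contradiction (sym e) w≢u′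
    distinct {suc (suc (suc zero))}   {suc (suc (suc zero))}   _ = refl

    step : ∀ i → adj G (c i) (c (next₄ i)) ≡ true
    step zero                   = trans (Graph.sym G v u) uv
    step (suc zero)             = uw
    step (suc (suc zero))       = trans (Graph.sym G w u′) u′w
    step (suc (suc (suc zero))) = u′v

  degree-as-∑ : ∀ v → degree G v ≡ ∑[ u < n ] χ (adj G u v)
  degree-as-∑ v = trans (length-filter-tabulate (λ u → T? (adj G v u)) id)
                        (sum-cong-≗ (λ u → cong χ (Graph.sym G v u)))

  codegree : Fin n → Fin n → ℕ
  codegree v w = ∑[ u < n ] (χ (adj G u v) * χ (adj G u w))

  codegree-diagonal : ∀ v → codegree v v ≡ degree G v
  codegree-diagonal v = trans (sum-cong-≗ (λ u → χ-idem (adj G u v))) (sym (degree-as-∑ v))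

  girth5⇒codegree≤1 : GirthAtLeast G 5 → ∀ v w → v ≢ w → codegree v w ≤ 1
  girth5⇒codegree≤1 girth v w v≢w = begin
    codegree v w                               ≡⟨ sum-cong-≗ (λ u → sym (χ-∧ (adj G u v) (adj G u w))) ⟩
    ∑[ u < n ] χ (adj G u v ∧ adj G u w)       ≤⟨ ∑-χ-unique _ unique ⟩
    1                                          ∎
    where
    open ≤-Reasoning
    unique : ∀ u u′ → adj G u v ∧ adj G u w ≡ true → adj G u′ v ∧ adj G u′ w ≡ true → u ≡ u′
    unique u u′ p q with u ≟ᶠ u′ | ∧-true p | ∧-true q
    ... | yes u≡u′ | _         | _           = u≡u′
    ... | no u≢u′  | uv , uw   | u′v , u′w   =
      contradiction (common-neighbours⇒cycle v≢w u≢u′ uv uw u′v u′w) (girth 4 (n<1+n 4))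

module SelectedNeighbours {n : ℕ} (G : Graph n)
  (codegree≤1 : ∀ v w → v ≢ w → codegree G v w ≤ 1) (S : Fin n → Bool) where

  s : Fin n → ℕ
  s = χ ∘ S

  h : ℕ
  h = sum s

  D : ℕ
  D = ∑[ v < n ] (s v * degree G v)

  hits : Fin n → ℕ
  hits u = ∑[ v < n ] (s v * χ (adj G u v))

  ∑-hits : sum hits ≡ D
  ∑-hits = trans (∑-comm (λ u v → s v * χ (adj G u v))) (sum-cong-≗ column)
    where
    column : ∀ v → ∑[ u < n ] (s v * χ (adj G u v)) ≡ s v * degree G v
    column v = trans (sym (*-distribˡ-sum (s v) (λ u → χ (adj G u v))))
                     (cong (s v *_) (sym (degree-as-∑ G v)))

  ∑-hits² : ∑[ u < n ] (hits u * hits u) ≡ ∑[ v < n ] ∑[ w < n ] (s v * s w * codegree G v w)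
  ∑-hits² = begin
    ∑[ u < n ] (hits u * hits u)
      ≡⟨ sum-cong-≗ (λ u → ∑-product (λ v → s v * χ (adj G u v)) (λ w → s w * χ (adj G u w))) ⟩
    ∑[ u < n ] ∑[ v < n ] ∑[ w < n ] term u v w
      ≡⟨ ∑-comm (λ u v → ∑[ w < n ] term u v w) ⟩
    ∑[ v < n ] ∑[ u < n ] ∑[ w < n ] term u v w
      ≡⟨ sum-cong-≗ (λ v → ∑-comm (λ u w → term u v w)) ⟩
    ∑[ v < n ] ∑[ w < n ] ∑[ u < n ] term u v w
      ≡⟨ sum-cong-≗ (λ v → sum-cong-≗ (λ w → pair v w)) ⟩
    ∑[ v < n ] ∑[ w < n ] (s v * s w * codegree G v w) ∎
    where
    open ≡-Reasoning
    term : Fin n → Fin n → Fin n → ℕ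
    term u v w = (s v * χ (adj G u v)) * (s w * χ (adj G u w))
    regroup : ∀ a x b y → (a * x) * (b * y) ≡ a * b * (x * y)
    regroup = solve-∀
    pair : ∀ v w → ∑[ u < n ] term u v w ≡ s v * s w * codegree G v w
    pair v w = trans (sum-cong-≗ (λ u → regroup (s v) (χ (adj G u v)) (s w) (χ (adj G u w))))
                     (sym (*-distribˡ-sum (s v * s w) (λ u → χ (adj G u v) * χ (adj G u w))))

  -- Diagonal pairs contribute D, off-diagonal pairs at most h².
  ∑-hits²-bound : ∑[ u < n ] (hits u * hits u) ≤ D + h * h
  ∑-hits²-bound = begin
    ∑[ u < n ] (hits u * hits u)
      ≡⟨ ∑-hits² ⟩
    ∑[ v < n ] ∑[ w < n ] (s v * s w * codegree G v w)
      ≤⟨ ∑-mono (λ v → ∑-single-out v (off-diagonal v)) ⟩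
    ∑[ v < n ] (s v * s v * codegree G v v + ∑[ w < n ] (s v * s w))
      ≡⟨ sum-cong-≗ (λ v → cong₂ _+_ (diagonal v) (sym (*-distribˡ-sum (s v) s))) ⟩
    ∑[ v < n ] (s v * degree G v + s v * h)
      ≡⟨ ∑-distrib-+ (λ v → s v * degree G v) (λ v → s v * h) ⟩
    D + ∑[ v < n ] (s v * h)
      ≡⟨ cong (D +_) (sym (*-distribʳ-sum h s)) ⟩
    D + h * h ∎
    where
    open ≤-Reasoning
    diagonal : ∀ v → s v * s v * codegree G v v ≡ s v * degree G v
    diagonal v = cong₂ _*_ (χ-idem (S v)) (codegree-diagonal G v)
    off-diagonal : ∀ v w → w ≢ v → s v * s w * codegree G v w ≤ s v * s w
    off-diagonal v w w≢v = ≤-trans (*-monoʳ-≤ (s v * s w) (codegree≤1 v w (w≢v ∘ sym)))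
                                   (≤-reflexive (*-identityʳ (s v * s w)))

  counting-bound : D * D ≤ n * (D + h * h)
  counting-bound = begin
    D * D                        ≡⟨ cong₂ _*_ (sym ∑-hits) (sym ∑-hits) ⟩
    sum hits * sum hits          ≤⟨ cauchy-schwarz hits ⟩
    n * ∑[ u < n ] (hits u * hits u) ≤⟨ *-monoʳ-≤ n ∑-hits²-bound ⟩
    n * (D + h * h)              ∎
    where open ≤-Reasoning

-- The final arithmetic: D² ≤ n (D + h²) and 4n h² ≤ D² force D ≤ 2n,
-- since they combine to 3D² ≤ 4nD, i.e. 3D ≤ 4n.
bound-from-squares : ∀ n D h → D * D ≤ n * (D + h * h) → 4 * n * (h * h) ≤ D * D → D ≤ 2 * n
bound-from-squares n zero      h _   _     = z≤n
bound-from-squares n D@(suc _) h D²≤ 4nh²≤ = *-cancelˡ-≤ 3 (begin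
  3 * D       ≤⟨ *-cancelʳ-≤ (3 * D) (4 * n) D 3D²≤4nD ⟩
  4 * n       ≤⟨ *-monoˡ-≤ n (m≤m+n 4 2) ⟩
  6 * n       ≡⟨ *-assoc 3 2 n ⟩
  3 * (2 * n) ∎)
  where
  open ≤-Reasoning
  split : ∀ x → x + 3 * x ≡ 4 * x
  split = solve-∀
  expand : ∀ n d k → 4 * (n * (d + k)) ≡ 4 * n * k + 4 * n * d
  expand = solve-∀
  3D²≤4nD : 3 * D * D ≤ 4 * n * D
  3D²≤4nD = +-cancelˡ-≤ (D * D) _ _ (begin
    D * D + 3 * D * D           ≡⟨ cong (D * D +_) (*-assoc 3 D D) ⟩
    D * D + 3 * (D * D)         ≡⟨ split (D * D) ⟩
    4 * (D * D)                 ≤⟨ *-monoʳ-≤ 4 D²≤ ⟩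
    4 * (n * (D + h * h))       ≡⟨ expand n D (h * h) ⟩
    4 * n * (h * h) + 4 * n * D ≤⟨ +-monoˡ-≤ (4 * n * D) 4nh²≤ ⟩
    D * D + 4 * n * D           ∎)

lemma1 : (n : ℕ) (G : Graph n) → GirthAtLeast G 5 → highDegreeSum G ≤ 2 * n
lemma1 n G girth = begin
  highDegreeSum G ≡⟨ sum-filter-tabulate high? (degree G) id ⟩
  D               ≤⟨ bound-from-squares n D h counting-bound high-bound ⟩
  2 * n           ∎
  where
  open ≤-Reasoning
  high? : ∀ v → Dec (4 * n ≤ degree G v * degree G v)
  high? v = 4 * n ≤? degree G v * degree G v
  open SelectedNeighbours G (girth5⇒codegree≤1 G girth) (λ v → does (high? v))
  high-bound : 4 * n * (h * h) ≤ D * D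
  high-bound = ∑-selected-square (4 * n) (degree G) high?
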